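{- Let $G$ be a finite simple connected graph of order $n(G)$ and clique number $\omega(G)$. Then: (i) for every $k\ge 0$, $\mathrm{f}\mu^{k}(G)=n(G)$ if and only if $\omega(G)=n(G)$; (ii) for every $k\ge 1$, $\mathrm{f}\mu^{k}(G)=n(G)-1$ if and only if $\omega(G)=n(G)-1$.
   Context: For an integer $k\ge 0$ and a connected graph $G$, a set $X\subseteq V(G)$ is a $k$-fault-tolerant mutual-visibility set ($k$-ftmv set) if for any two non-adjacent vertices $u,v\in X$ there exist $k+1$ internally vertex-disjoint shortest $u,v$-paths $Q_1,\dots,Q_{k+1}$ in $G$ such that $V(Q_i)\cap X=\{u,v\}$ for every $i$. $\mathrm{f}\mu^{k}(G)$ denotes the maximum cardinality of a $k$-ftmv set of $G$. -}

module Defs where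

open import Data.Nat using (ℕ; zero; suc; _≤_)
open import Data.Fin using (Fin)
open import Data.Fin.Subset using (Subset; _∈_; ∣_∣)
open import Data.Bool using (Bool; true; false)
open import Data.List using (List; []; _∷_)
open import Data.List.Membership.Propositional using () renaming (_∈_ to _∈ₗ_)
open import Data.Product using (Σ; _×_; _,_)
open import Data.Sum using (_⊎_)
open import Data.Empty using (⊥)
open import Relation.Nullary using (¬_)
open import Relation.Binary.PropositionalEquality using (_≡_; _≢_)

record Graph (n : ℕ) : Set where
  field
    adj   : Fin n → Fin n → Bool
    sym   : ∀ u v → adj u v ≡ adj v u
    irrefl : ∀ u → adj u u ≡ false

module _ {n : ℕ} (G : Graph n) where
  open Graph G

  Adj : Fin n → Fin n → Set
  Adj u v = adj u v ≡ true

  data Walk : Fin n → Fin n → Set where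
    here : ∀ {u} → Walk u u
    step : ∀ {u w v} → Adj u w → Walk w v → Walk u v

  len : ∀ {u v} → Walk u v → ℕ
  len here = zero
  len (step _ W) = suc (len W)

  verts : ∀ {u v} → Walk u v → List (Fin n)
  verts {u} here = u ∷ []
  verts {u} (step _ W) = u ∷ verts W

  Connected : Set
  Connected = ∀ u v → Walk u v

  -- a shortest u,v-path: a u,v-walk of minimum length (necessarily a path)
  IsShortest : ∀ {u v} → Walk u v → Set
  IsShortest {u} {v} Q = ∀ (W : Walk u v) → len Q ≤ len W

  Internal : ∀ {u v} → Fin n → Walk u v → Set
  Internal {u} {v} x Q = (x ∈ₗ verts Q) × (x ≢ u) × (x ≢ v)

  AvoidsExcept : ∀ {u v} → Subset n → Walk u v → Set
  AvoidsExcept {u} {v} X Q = ∀ x → x ∈ₗ verts Q → x ∈ X → (x ≡ u ⊎ x ≡ v)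

  IsFTMV : ℕ → Subset n → Set
  IsFTMV k X =
    ∀ u v → u ∈ X → v ∈ X → u ≢ v → ¬ Adj u v →
    Σ (Fin (suc k) → Walk u v) λ Q →
        (∀ i → IsShortest (Q i))
      × (∀ i j → i ≢ j → ∀ x → Internal x (Q i) → Internal x (Q j) → ⊥)
      × (∀ i → AvoidsExcept X (Q i))

  IsFμ : ℕ → ℕ → Set
  IsFμ k m = (Σ (Subset n) λ X → IsFTMV k X × ∣ X ∣ ≡ m)
           × (∀ X → IsFTMV k X → ∣ X ∣ ≤ m)

  IsClique : Subset n → Set
  IsClique X = ∀ u v → u ∈ X → v ∈ X → u ≢ v → Adj u v

  IsCliqueNumber : ℕ → Set
  IsCliqueNumber w = (Σ (Subset n) λ X → IsClique X × ∣ X ∣ ≡ w)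
                   × (∀ X → IsClique X → ∣ X ∣ ≤ w)

{-# OPTIONS --safe #-}

-- Every clique is a k-ftmv set for trivial reasons, so ω(G) ≤ fμ^k(G).
-- Conversely, if u, v ∈ X are non-adjacent, the second vertices of the k + 1
-- internally disjoint u,v-paths are k + 1 distinct vertices outside X; hence
-- a k-ftmv set missing at most k vertices is a clique.  So fμ^k(G) = ω(G) as
-- soon as either reaches n − k, which gives (i) and, for k ≥ 1, (ii).
module Submission where

open import Defs
open import Data.Nat using (ℕ; zero; suc; _≤_; _<_; _+_; _∸_; z≤n; s≤s)
open import Data.Nat.Properties
  using (≤-antisym; ≤-trans; <⇒≱; +-monoˡ-≤; +-monoʳ-≤; m≤m+n; m≤n+o⇒m∸n≤o; m∸n+n≡m; module ≤-Reasoning)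
open import Data.Fin using (Fin; zero; suc) renaming (_≟_ to _≟ᶠ_)
open import Data.Fin.Properties using (suc-injective)
open import Data.Fin.Subset using (Subset; _∈_; _∉_; ∣_∣; ∁; _-_)
open import Data.Fin.Subset.Properties
  using (x∈p∧x≢y⇒x∈p-y; x∈p⇒∣p-x∣<∣p∣; x∉p⇒x∈∁p; ∣∁p∣≡n∸∣p∣)
open import Data.Bool using (true)
open import Data.Bool.Properties using () renaming (_≟_ to _≟ᵇ_)
open import Data.List.Relation.Unary.Any using (here; there)
open import Data.Product using (∃; _×_; _,_; proj₁; proj₂)
open import Data.Sum using (inj₁; inj₂)
open import Data.Empty using (⊥-elim)
open import Function.Bundles using (_⇔_; mk⇔)
open import Function.Definitions using (Injective)
open import Relation.Nullary using (¬_; yes; no; contradiction)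
open import Relation.Binary.PropositionalEquality
  using (_≡_; _≢_; refl; sym; trans; cong; subst)

injective-into-subset⇒≤∣p∣ : ∀ {m n} {p : Subset n} (f : Fin m → Fin n) →
  Injective _≡_ _≡_ f → (∀ i → f i ∈ p) → m ≤ ∣ p ∣
injective-into-subset⇒≤∣p∣ {zero}  f _   _   = z≤n
injective-into-subset⇒≤∣p∣ {suc m} {p = p} f inj f∈p =
  ≤-trans (s≤s (injective-into-subset⇒≤∣p∣ (λ i → f (suc i)) (λ e → suc-injective (inj e)) f∈p-f₀))
          (x∈p⇒∣p-x∣<∣p∣ (f∈p zero))
  where
  f∈p-f₀ : ∀ i → f (suc i) ∈ p - f zero
  f∈p-f₀ i = x∈p∧x≢y⇒x∈p-y (f∈p (suc i)) (λ e → contradiction (inj e) λ ())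

module _ {n : ℕ} (G : Graph n) where
  open Graph G using (adj; irrefl)

  adj⇒≢ : ∀ {u v} → Adj G u v → u ≢ v
  adj⇒≢ {u} uv refl = contradiction (trans (sym uv) (irrefl u)) λ ()

  nonadjacent-walk-internal : ∀ {u v} → u ≢ v → ¬ Adj G u v →
    (Q : Walk G u v) → ∃ λ y → Internal G y Q
  nonadjacent-walk-internal u≢v _   here           = ⊥-elim (u≢v refl)
  nonadjacent-walk-internal _   ¬uv (step uy here) = ⊥-elim (¬uv uy)
  nonadjacent-walk-internal _   ¬uv (step {w = y} uy (step _ _)) =
    y , there (here refl) , (λ y≡u → adj⇒≢ uy (sym y≡u)) , λ { refl → ¬uv uy }

  internal-avoiding⇒∉ : ∀ {u v y} {X : Subset n} {Q : Walk G u v} →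
    AvoidsExcept G X Q → Internal G y Q → y ∉ X
  internal-avoiding⇒∉ avoids (y∈Q , y≢u , y≢v) y∈X with avoids _ y∈Q y∈X
  ... | inj₁ y≡u = y≢u y≡u
  ... | inj₂ y≡v = y≢v y≡v

  ftmv-nonadjacent⇒k<∣∁X∣ : ∀ {k u v} {X : Subset n} → IsFTMV G k X →
    u ∈ X → v ∈ X → u ≢ v → ¬ Adj G u v → k < ∣ ∁ X ∣
  ftmv-nonadjacent⇒k<∣∁X∣ {k} ftmv u∈X v∈X u≢v ¬uv
    with Q , _ , disjoint , avoids ← ftmv _ _ u∈X v∈X u≢v ¬uv =
    injective-into-subset⇒≤∣p∣ inner inner-injective
      (λ i → x∉p⇒x∈∁p (internal-avoiding⇒∉ (avoids i) (inner-internal i)))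
    where
    inner-vertex : ∀ i → ∃ λ y → Internal G y (Q i)
    inner-vertex i = nonadjacent-walk-internal u≢v ¬uv (Q i)

    inner : Fin (suc k) → Fin n
    inner i = proj₁ (inner-vertex i)

    inner-internal : ∀ i → Internal G (inner i) (Q i)
    inner-internal i = proj₂ (inner-vertex i)

    inner-injective : Injective _≡_ _≡_ inner
    inner-injective {i} {j} inner-i≡inner-j with i ≟ᶠ j
    ... | yes i≡j = i≡j
    ... | no  i≢j = ⊥-elim (disjoint i j i≢j (inner i) (inner-internal i)
                      (subst (λ y → Internal G y (Q j)) (sym inner-i≡inner-j) (inner-internal j)))

  ftmv∧∣∁X∣≤k⇒clique : ∀ {k} {X : Subset n} → IsFTMV G k X → ∣ ∁ X ∣ ≤ k → IsClique G X
  ftmv∧∣∁X∣≤k⇒clique ftmv ∣∁X∣≤k u v u∈X v∈X u≢v with adj u v ≟ᵇ true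
  ... | yes uv = uv
  ... | no ¬uv = contradiction ∣∁X∣≤k (<⇒≱ (ftmv-nonadjacent⇒k<∣∁X∣ ftmv u∈X v∈X u≢v ¬uv))

  clique⇒ftmv : ∀ {k} {X : Subset n} → IsClique G X → IsFTMV G k X
  clique⇒ftmv clique u v u∈X v∈X u≢v ¬uv = ⊥-elim (¬uv (clique u v u∈X v∈X u≢v))

  module _ {k m w : ℕ} (ω≡w : IsCliqueNumber G w) (fμ≡m : IsFμ G k m) where

    ω≤fμ : w ≤ m
    ω≤fμ with (C , clique , ∣C∣≡w) ← proj₁ ω≡w =
      subst (_≤ m) ∣C∣≡w (proj₂ fμ≡m C (clique⇒ftmv clique))

    fμ≡ω : n ≤ m + k → m ≡ w
    fμ≡ω n≤m+k with (X , ftmv , ∣X∣≡m) ← proj₁ fμ≡m =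
      ≤-antisym (subst (_≤ w) ∣X∣≡m (proj₂ ω≡w X (ftmv∧∣∁X∣≤k⇒clique ftmv ∣∁X∣≤k))) ω≤fμ
      where
      open ≤-Reasoning
      ∣∁X∣≤k : ∣ ∁ X ∣ ≤ k
      ∣∁X∣≤k = begin
        ∣ ∁ X ∣    ≡⟨ ∣∁p∣≡n∸∣p∣ X ⟩
        n ∸ ∣ X ∣  ≡⟨ cong (n ∸_) ∣X∣≡m ⟩
        n ∸ m      ≤⟨ m≤n+o⇒m∸n≤o n m n≤m+k ⟩
        k          ∎

    fμ≡t⇔ω≡t : ∀ {t} → n ≤ t + k → (m ≡ t ⇔ w ≡ t)
    fμ≡t⇔ω≡t n≤t+k = mk⇔
      (λ m≡t → trans (sym (fμ≡ω (subst (λ s → n ≤ s + k) (sym m≡t) n≤t+k))) m≡t)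
      (λ w≡t → trans (fμ≡ω (≤-trans n≤t+k (+-monoˡ-≤ k (subst (_≤ m) w≡t ω≤fμ)))) w≡t)

n≤n∸1+k : ∀ {n k} → 1 ≤ n → 1 ≤ k → n ≤ n ∸ 1 + k
n≤n∸1+k {n} {k} 1≤n 1≤k = begin
  n          ≡⟨ sym (m∸n+n≡m 1≤n) ⟩
  n ∸ 1 + 1  ≤⟨ +-monoʳ-≤ (n ∸ 1) 1≤k ⟩
  n ∸ 1 + k  ∎
  where open ≤-Reasoning

corollary5p2 : ∀ (n : ℕ) (G : Graph n) → 1 ≤ n → Connected G →
    ∀ (w : ℕ) → IsCliqueNumber G w →
      (∀ (k m : ℕ) → IsFμ G k m → (m ≡ n ⇔ w ≡ n))
      × (∀ (k m : ℕ) → 1 ≤ k → IsFμ G k m → (m ≡ n ∸ 1 ⇔ w ≡ n ∸ 1))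
corollary5p2 n G 1≤n _ w ω≡w =
    (λ k m fμ≡m → fμ≡t⇔ω≡t G ω≡w fμ≡m (m≤m+n n k))
  , (λ k m 1≤k fμ≡m → fμ≡t⇔ω≡t G ω≡w fμ≡m (n≤n∸1+k 1≤n 1≤k))
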